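{- Let $k\ge1$ and let $\mathbf c^{(0)},\dots,\mathbf c^{(k)}$ be compositions with $\mathbf c^{(k)}\ne\epsilon$. Then $$\mathrm P\big(\mathbf c^{(0)}\oplus(3)\oplus\mathbf c^{(1)}\oplus(3)\oplus\cdots\oplus(3)\oplus\mathbf c^{(k)}\big)=\binom{\sum_{i=0}^k|\mathbf c^{(i)}|+3k}{|\mathbf c^{(0)}|+1,\;3+|\mathbf c^{(1)}|,\ldots,3+|\mathbf c^{(k-1)}|,\;|\mathbf c^{(k)}|+2}\,\mathrm P(\mathbf c^{(0)}\oplus(1))\left(\prod_{i=1}^{k-1}\mathrm P((2)\oplus\mathbf c^{(i)}\oplus(1))\right)\mathrm P((2)\oplus\mathbf c^{(k)}),$$ where the first factor is a multinomial coefficient.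
   Context: Permutations $\sigma\in\mathcal S_n$ are words $\sigma_1\cdots\sigma_n$; $i$ is a peak if $\sigma_{i-1}<\sigma_i>\sigma_{i+1}$. A composition of $n$ is a finite sequence of positive integers summing to $n$; $|\mathbf c|$ is its size; $\epsilon$ is the empty composition, $|\epsilon|=0$. If the peak set of $\sigma\in\mathcal S_n$ is $\{i_1<\dots<i_k\}$, its peak-composition is $(c_1,\dots,c_{k+1})$, $c_j=i_j-i_{j-1}$, $i_0=0$, $i_{k+1}=n$. $\mathrm P(\mathbf c)$ is the number of $\sigma\in\mathcal S_{|\mathbf c|}$ with peak-composition $\mathbf c$. $\oplus$ denotes concatenation, with $\epsilon$ as identity. -}

module Defs where

open import Data.Nat using (ℕ; zero; suc; _+_; _*_; _∸_; _<_; _<ᵇ_; _/_; NonZero; _!)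
open import Data.Nat.ListAction using (sum; product)
open import Data.Nat.Properties using (m*n≢0; _!≢0)
open import Data.Bool using (if_then_else_; _∧_)
open import Data.List using (List; []; _∷_; _++_; [_]; length; map; concatMap; applyUpTo; filter)
open import Data.List.Relation.Unary.All using (All)
open import Data.List.Relation.Unary.Unique.Propositional using (Unique)
open import Data.List.Relation.Unary.Unique.DecPropositional using (unique?)
open import Data.List.Properties using (≡-dec)
import Data.Nat.Properties as ℕP

-- A composition is a list of positive integers; ε is the empty list [].
Composition : Set
Composition = List ℕ

IsComposition : Composition → Set
IsComposition c = All (λ x → 0 < x) c

size : Composition → ℕ
size c = sum c

-- ⊕ is list concatenation _++_ (with [] as identity).

words : ℕ → ℕ → List (List ℕ)
words zero    n = [] ∷ []
words (suc m) n = concatMap (λ a → map (a ∷_) (words m n)) (applyUpTo suc n)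

-- S_n : the permutations of [n] = {1,…,n} in one-line notation σ₁⋯σₙ,
-- i.e. the words of length n over {1,…,n} with pairwise distinct letters.
perms : ℕ → List (List ℕ)
perms n = filter (unique? ℕP._≟_) (words n n)

-- Peak positions (1-indexed): i is a peak if σ_{i-1} < σ_i > σ_{i+1}.
-- peaksFrom j w : peaks of w, where the first letter of w sits at position j.
peaksFrom : ℕ → List ℕ → List ℕ
peaksFrom j (a ∷ b ∷ c ∷ w) =
  if (a <ᵇ b) ∧ (c <ᵇ b)
  then suc j ∷ peaksFrom (suc j) (b ∷ c ∷ w)
  else peaksFrom (suc j) (b ∷ c ∷ w)
peaksFrom j _ = []

peakSet : List ℕ → List ℕ
peakSet σ = peaksFrom 1 σ

-- differences of consecutive peaks, with i₀ = 0 and i_{k+1} = n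
diffs : ℕ → ℕ → List ℕ → List ℕ
diffs n prev []       = (n ∸ prev) ∷ []
diffs n prev (i ∷ is) = (i ∸ prev) ∷ diffs n i is

peakComp : List ℕ → Composition
peakComp []      = []
peakComp (x ∷ σ) = diffs (length (x ∷ σ)) 0 (peakSet (x ∷ σ))

P : Composition → ℕ
P c = length (filter (λ σ → ≡-dec ℕP._≟_ (peakComp σ) c) (perms (size c)))

prodFact : List ℕ → ℕ
prodFact ps = product (map (λ p → p !) ps)

prodFact≢0 : (ps : List ℕ) → NonZero (prodFact ps)
prodFact≢0 []       = _
prodFact≢0 (p ∷ ps) = m*n≢0 (p !) (prodFact ps) {{p !≢0}} {{prodFact≢0 ps}}

multinomial : ℕ → List ℕ → ℕ
multinomial n ps = (n ! / prodFact ps) {{prodFact≢0 ps}}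

join3 : (ℕ → Composition) → ℕ → Composition
join3 c zero    = c 0
join3 c (suc k) = join3 c k ++ (3 ∷ c (suc k))

range1 : ℕ → List ℕ
range1 m = applyUpTo suc m

range0 : ℕ → List ℕ
range0 m = applyUpTo (λ i → i) m

module Submission where

-- The heart of the argument is the single-cut case (`P-cut-at-3`): for a
-- composition A and a nonempty B,
--   P (A ⊕ (3) ⊕ B) = C(|A|+1+|B|+2, |A|+1) · P (A ⊕ (1)) · P ((2) ⊕ B).
-- A permutation σ of [|A|+1+|B|+2] has peak-composition A ⊕ (3) ⊕ B exactly
-- when its prefix u of length |A|+1 has peak-composition A ⊕ (1) and its
-- suffix v has peak-composition (2) ⊕ B (`cut-at-3⇒` / `cut-at-3⇐`): the two
-- non-peaks around the cut separate u from v.  Since peak-compositions depend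
-- only on relative order (`peakComp-relabel`), σ corresponds bijectively to
-- the triple (set of values used by u, standardisation of u, standardisation
-- of v), and counting the value sets gives the binomial coefficient.

open import Defs
open import Data.Nat
  using (ℕ; zero; suc; pred; _+_; _*_; _∸_; _≤_; _<_; z≤n; s≤s; _<ᵇ_; _/_; _!; _⊓_)
open import Data.Nat.Properties
open import Data.Nat.ListAction using (sum; product)
open import Data.Nat.ListAction.Properties using (sum-++; product-++)
open import Data.Nat.DivMod using (m*n/n≡m)
open import Data.Nat.Tactic.RingSolver using (solve-∀)
open import Data.Bool using (Bool; true; false; not; _∧_; if_then_else_)
open import Data.List
  using (List; []; _∷_; _++_; [_]; map; length; filter; concatMap; upTo; take; drop; cartesianProduct)
open import Data.List.Properties
  using ( length-++; length-map; length-applyUpTo; length-upTo; length-take; length-drop; ∷-injectiveˡ; ∷-injectiveʳ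
        ; ∷ʳ-injective; ++-assoc; map-++; map-∘; map-upTo; map-id-local; map-cong-local; applyUpTo-∷ʳ
        ; take++drop≡id; ≡-dec)
open import Data.List.Membership.Propositional using (_∈_; _∉_; lose; find)
open import Data.List.Membership.Propositional.Properties
open import Data.List.Membership.DecPropositional _≟_ using (_∈?_)
open import Data.List.Relation.Unary.Any using (here; there)
open import Data.List.Relation.Unary.All using (All; []; _∷_)
import Data.List.Relation.Unary.All as All
import Data.List.Relation.Unary.All.Properties as All
open import Data.List.Relation.Unary.AllPairs using ([]; _∷_)
open import Data.List.Relation.Unary.Unique.Propositional using (Unique)
open import Data.List.Relation.Unary.Unique.DecPropositional using (unique?)
import Data.List.Relation.Unary.Unique.Propositional.Properties as Unique
open import Data.Product using (∃; ∃₂; _×_; _,_; proj₁; proj₂; map₁; map₂)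
open import Data.Sum using (inj₁; inj₂)
open import Data.Empty using (⊥; ⊥-elim)
open import Relation.Nullary using (yes; no; does)
open import Relation.Nullary.Decidable using (dec-true; dec-false)
open import Relation.Unary using (Decidable)
open import Relation.Binary.Definitions using (tri<; tri≈; tri>)
open import Relation.Binary.PropositionalEquality
  using (_≡_; _≢_; refl; sym; trans; cong; cong₂; subst; subst₂; module ≡-Reasoning)

∈-delete : ∀ {A : Set} {y z : A} (xs ys : List A) → y ∈ xs ++ z ∷ ys → y ≢ z → y ∈ xs ++ ys
∈-delete xs ys y∈ y≢z with ∈-++⁻ xs y∈
... | inj₁ p         = ∈-++⁺ˡ p
... | inj₂ (here eq) = ⊥-elim (y≢z eq)
... | inj₂ (there p) = ∈-++⁺ʳ xs p

length-delete : ∀ {A : Set} (xs : List A) (z : A) ys → length (xs ++ z ∷ ys) ≡ suc (length (xs ++ ys))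
length-delete []       z ys = refl
length-delete (x ∷ xs) z ys = cong suc (length-delete xs z ys)

length-≤-injection : ∀ {A B : Set} (f : A → B) (xs : List A) (ys : List B) → Unique xs →
  (∀ {x} → x ∈ xs → f x ∈ ys) →
  (∀ {x x′} → x ∈ xs → x′ ∈ xs → f x ≡ f x′ → x ≡ x′) →
  length xs ≤ length ys
length-≤-injection f []       ys _          _   _   = z≤n
length-≤-injection f (x ∷ xs) ys (x∉xs ∷ u) mem inj with ∈-∃++ (mem (here refl))
... | ys₁ , ys₂ , refl = subst (suc (length xs) ≤_) (sym (length-delete ys₁ (f x) ys₂))
  (s≤s (length-≤-injection f xs (ys₁ ++ ys₂) u mem′ (λ p q → inj (there p) (there q))))
  where
  mem′ : ∀ {x′} → x′ ∈ xs → f x′ ∈ ys₁ ++ ys₂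
  mem′ p = ∈-delete ys₁ ys₂ (mem (there p)) (λ e → All.lookup x∉xs p (sym (inj (there p) (here refl) e)))

length-≡-bijection : ∀ {A B : Set} (f : A → B) (g : B → A) (xs : List A) (ys : List B) →
  Unique xs → Unique ys →
  (∀ {x} → x ∈ xs → f x ∈ ys) → (∀ {x} → x ∈ xs → g (f x) ≡ x) →
  (∀ {y} → y ∈ ys → g y ∈ xs) → (∀ {y} → y ∈ ys → f (g y) ≡ y) →
  length xs ≡ length ys
length-≡-bijection f g xs ys uxs uys f∈ gf g∈ fg = ≤-antisym
  (length-≤-injection f xs ys uxs f∈ (λ p q e → trans (sym (gf p)) (trans (cong g e) (gf q))))
  (length-≤-injection g ys xs uys g∈ (λ p q e → trans (sym (fg p)) (trans (cong f e) (fg q))))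

map-unique : ∀ {A B : Set} (f : A → B) xs → Unique xs →
  (∀ {x y} → x ∈ xs → y ∈ xs → f x ≡ f y → x ≡ y) → Unique (map f xs)
map-unique f []       _          _   = []
map-unique f (x ∷ xs) (x∉xs ∷ u) inj =
  All.tabulate fresh ∷ map-unique f xs u (λ p q → inj (there p) (there q))
  where
  fresh : ∀ {z} → z ∈ map f xs → f x ≢ z
  fresh z∈ with ∈-map⁻ f z∈
  ... | y , y∈ , refl = λ e → All.lookup x∉xs y∈ (inj (here refl) (there y∈) e)

unique-++-disjoint : ∀ {A : Set} (xs ys : List A) {x} → Unique (xs ++ ys) → x ∈ xs → x ∉ ys
unique-++-disjoint (z ∷ xs) ys (z∉ ∷ u) (here refl) q = All.lookup z∉ (∈-++⁺ʳ xs q) refl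
unique-++-disjoint (z ∷ xs) ys (z∉ ∷ u) (there p)   q = unique-++-disjoint xs ys u p q

length-cartesianProduct : ∀ {A B : Set} (xs : List A) (ys : List B) →
  length (cartesianProduct xs ys) ≡ length xs * length ys
length-cartesianProduct []       ys = refl
length-cartesianProduct (x ∷ xs) ys =
  trans (length-++ (map (x ,_) ys)) (cong₂ _+_ (length-map (x ,_) ys) (length-cartesianProduct xs ys))

take-length-++ : ∀ {A : Set} (xs ys : List A) → take (length xs) (xs ++ ys) ≡ xs
take-length-++ []       ys = refl
take-length-++ (x ∷ xs) ys = cong (x ∷_) (take-length-++ xs ys)

drop-length-++ : ∀ {A : Set} (xs ys : List A) → drop (length xs) (xs ++ ys) ≡ ys
drop-length-++ []       ys = refl
drop-length-++ (x ∷ xs) ys = drop-length-++ xs ys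

InRange : ℕ → ℕ → Set
InRange n x = 1 ≤ x × x ≤ n

pred<-InRange : ∀ {n x} → InRange n x → pred x < n
pred<-InRange {x = suc x} (_ , x<n) = x<n

suc-pred-InRange : ∀ {n x} → InRange n x → suc (pred x) ≡ x
suc-pred-InRange {x = suc x} _ = refl

∈range1⁺ : ∀ n x → InRange n x → x ∈ range1 n
∈range1⁺ n (suc x) (_ , x<n) = ∈-applyUpTo⁺ suc x<n

∈range1⁻ : ∀ {n x} → x ∈ range1 n → InRange n x
∈range1⁻ p with ∈-applyUpTo⁻ suc p
... | _ , i<n , refl = s≤s z≤n , i<n

range1-unique : ∀ n → Unique (range1 n)
range1-unique n = Unique.applyUpTo⁺₁ suc n (λ i<j _ e → <⇒≢ i<j (suc-injective e))

∈words⁻ : ∀ m n w → w ∈ words m n → length w ≡ m × All (InRange n) w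
∈words⁻ zero    n .[] (here refl) = refl , []
∈words⁻ (suc m) n w   p with find (∈-concatMap⁻ _ {xs = range1 n} p)
... | a , a∈ , q with ∈-map⁻ _ q | ∈range1⁻ a∈
... | w′ , w′∈ , refl | a-in with ∈words⁻ m n w′ w′∈
... | len , all = cong suc len , a-in ∷ all

∈words⁺ : ∀ m n w → length w ≡ m → All (InRange n) w → w ∈ words m n
∈words⁺ zero    n []      refl []             = here refl
∈words⁺ (suc m) n (a ∷ w) len  (a-in ∷ all) =
  ∈-concatMap⁺ _ {xs = range1 n}
    (lose (∈range1⁺ n a a-in) (∈-map⁺ (a ∷_) (∈words⁺ m n w (suc-injective len) all)))

words-unique : ∀ m n → Unique (words m n)
words-unique zero    n = [] ∷ []
words-unique (suc m) n = prefixed (range1 n) (range1-unique n)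
  where
  prefixed : ∀ as → Unique as → Unique (concatMap (λ a → map (a ∷_) (words m n)) as)
  prefixed []       _          = []
  prefixed (a ∷ as) (a∉as ∷ u) =
    Unique.++⁺ (Unique.map⁺ ∷-injectiveʳ (words-unique m n)) (prefixed as u) disjoint
    where
    disjoint : ∀ {w} → w ∈ map (a ∷_) (words m n) × w ∈ concatMap (λ a → map (a ∷_) (words m n)) as → ⊥
    disjoint (p , q) with ∈-map⁻ _ p
    ... | _ , _ , refl with find (∈-concatMap⁻ _ {xs = as} q)
    ... | b , b∈ , r with ∈-map⁻ _ r
    ... | _ , _ , e = All.lookup a∉as b∈ (∷-injectiveˡ e)

∈perms⁻ : ∀ n σ → σ ∈ perms n → length σ ≡ n × All (InRange n) σ × Unique σ
∈perms⁻ n σ p with ∈-filter⁻ (unique? _≟_) {xs = words n n} p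
... | σ∈ , u = proj₁ (∈words⁻ n n σ σ∈) , proj₂ (∈words⁻ n n σ σ∈) , u

∈perms⁺ : ∀ n σ → length σ ≡ n → All (InRange n) σ → Unique σ → σ ∈ perms n
∈perms⁺ n σ len all u = ∈-filter⁺ (unique? _≟_) (∈words⁺ n n σ len all) u

perms-unique : ∀ n → Unique (perms n)
perms-unique n = Unique.filter⁺ (unique? _≟_) (words-unique n n)

-- Pigeonhole: a permutation of [n] contains every letter of [n].
perm-covers : ∀ n σ → σ ∈ perms n → ∀ x → InRange n x → x ∈ σ
perm-covers n σ σ∈ x x-in with ∈perms⁻ n σ σ∈ | x ∈? σ
... | _ , _ , _ | yes x∈σ = x∈σ
... | len , all , u | no x∉σ =
  ⊥-elim (<-irrefl refl (subst₂ (λ a b → suc a ≤ b) len (length-applyUpTo suc n) too-long))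
  where
  too-long : length (x ∷ σ) ≤ length (range1 n)
  too-long = length-≤-injection (λ y → y) (x ∷ σ) (range1 n)
    (All.tabulate (λ {y} y∈ e → x∉σ (subst (_∈ σ) (sym e) y∈)) ∷ u)
    (λ { (here refl) → ∈range1⁺ n x x-in ; (there p) → ∈range1⁺ n _ (All.lookup all p) })
    (λ _ _ e → e)

<ᵇ-true : ∀ m n → m < n → (m <ᵇ n) ≡ true
<ᵇ-true zero    (suc n) _         = refl
<ᵇ-true (suc m) (suc n) (s≤s m<n) = <ᵇ-true m n m<n

<ᵇ-false : ∀ m n → n ≤ m → (m <ᵇ n) ≡ false
<ᵇ-false m       zero    _         = refl
<ᵇ-false (suc m) (suc n) (s≤s n≤m) = <ᵇ-false m n n≤m

<ᵇ-sound : ∀ m n → (m <ᵇ n) ≡ true → m < n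
<ᵇ-sound zero    (suc n) _ = s≤s z≤n
<ᵇ-sound (suc m) (suc n) e = s≤s (<ᵇ-sound m n e)

<ᵇ-asym : ∀ m n → (m <ᵇ n) ≡ true → (n <ᵇ m) ≡ false
<ᵇ-asym m n e = <ᵇ-false n m (<⇒≤ (<ᵇ-sound m n e))

∧-false : ∀ x → (x ∧ false) ≡ false
∧-false true  = refl
∧-false false = refl

isPeak : ℕ → ℕ → ℕ → Bool
isPeak a b c = (a <ᵇ b) ∧ (c <ᵇ b)

-- Bit j of `peakBits w` says whether position j+2 of w is a peak; a word of
-- length n ≥ 2 has n ∸ 2 peak bits.
peakBits : List ℕ → List Bool
peakBits (a ∷ b ∷ c ∷ w) = isPeak a b c ∷ peakBits (b ∷ c ∷ w)
peakBits _               = []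

length-peakBits : ∀ a b w → length (peakBits (a ∷ b ∷ w)) ≡ length w
length-peakBits a b []      = refl
length-peakBits a b (c ∷ w) = cong suc (length-peakBits b c w)

truePositions : ℕ → List Bool → List ℕ
truePositions j []       = []
truePositions j (x ∷ bs) = if x then suc j ∷ truePositions (suc j) bs else truePositions (suc j) bs

peaksFrom-bits : ∀ j w → peaksFrom j w ≡ truePositions j (peakBits w)
peaksFrom-bits j (a ∷ b ∷ c ∷ w) rewrite peaksFrom-bits (suc j) (b ∷ c ∷ w) = refl
peaksFrom-bits j []              = refl
peaksFrom-bits j (a ∷ [])        = refl
peaksFrom-bits j (a ∷ b ∷ [])    = refl

-- Reading the bits left to right while `acc` letters of the current part have
-- been seen: `blocks` lists the completed parts (each closed by a true bit)
-- and `openBlock` is the length of the unfinished part.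
blocks : ℕ → List Bool → List ℕ
blocks acc []           = []
blocks acc (true  ∷ bs) = suc acc ∷ blocks 0 bs
blocks acc (false ∷ bs) = blocks (suc acc) bs

openBlock : ℕ → List Bool → ℕ
openBlock acc []           = acc
openBlock acc (true  ∷ bs) = openBlock 0 bs
openBlock acc (false ∷ bs) = openBlock (suc acc) bs

-- The composition cut out by the bits; the final part also takes the last letter.
compOfBits : ℕ → List Bool → Composition
compOfBits acc bs = blocks acc bs ++ [ openBlock acc bs + 1 ]

diffs-truePositions : ∀ j prev bs → prev ≤ j →
  diffs (j + length bs + 1) prev (truePositions j bs) ≡ compOfBits (j ∸ prev) bs
diffs-truePositions j prev [] prev≤j rewrite +-identityʳ j = cong [_] (+-∸-comm 1 prev≤j)
diffs-truePositions j prev (true ∷ bs) prev≤j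
  rewrite +-suc j (length bs) | diffs-truePositions (suc j) (suc j) bs ≤-refl | n∸n≡0 j
  = cong (_∷ compOfBits 0 bs) (+-∸-assoc 1 prev≤j)
diffs-truePositions j prev (false ∷ bs) prev≤j
  rewrite +-suc j (length bs) | diffs-truePositions (suc j) prev bs (m≤n⇒m≤1+n prev≤j)
  = cong (λ z → compOfBits z bs) (+-∸-assoc 1 prev≤j)

-- The peak-composition of a word of length ≥ 2, read off its peak bits: the
-- first letter starts the first part.
peakComp-bits : ∀ a b w → peakComp (a ∷ b ∷ w) ≡ compOfBits 1 (peakBits (a ∷ b ∷ w))
peakComp-bits a b w = begin
    diffs (suc (suc (length w))) 0 (peaksFrom 1 (a ∷ b ∷ w))
  ≡⟨ cong₂ (λ n l → diffs n 0 l) len (peaksFrom-bits 1 (a ∷ b ∷ w)) ⟩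
    diffs (1 + length (peakBits (a ∷ b ∷ w)) + 1) 0 (truePositions 1 (peakBits (a ∷ b ∷ w)))
  ≡⟨ diffs-truePositions 1 0 (peakBits (a ∷ b ∷ w)) z≤n ⟩
    compOfBits 1 (peakBits (a ∷ b ∷ w)) ∎
  where
  open ≡-Reasoning
  len : suc (suc (length w)) ≡ 1 + length (peakBits (a ∷ b ∷ w)) + 1
  len rewrite length-peakBits a b w = cong suc (+-comm 1 (length w))

StrictlyIncreasingOn : (ℕ → ℕ) → List ℕ → Set
StrictlyIncreasingOn f w = ∀ {x y} → x ∈ w → y ∈ w → x < y → f x < f y

<ᵇ-relabel : ∀ f w → StrictlyIncreasingOn f w → ∀ {x y} → x ∈ w → y ∈ w → (f x <ᵇ f y) ≡ (x <ᵇ y)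
<ᵇ-relabel f w inc {x} {y} x∈ y∈ with <-cmp x y
... | tri< x<y _ _    = trans (<ᵇ-true _ _ (inc x∈ y∈ x<y)) (sym (<ᵇ-true _ _ x<y))
... | tri≈ _ refl _   = trans (<ᵇ-false (f x) (f x) ≤-refl) (sym (<ᵇ-false x x ≤-refl))
... | tri> _ _ y<x    = trans (<ᵇ-false _ _ (<⇒≤ (inc y∈ x∈ y<x))) (sym (<ᵇ-false _ _ (<⇒≤ y<x)))

peakBits-relabel : ∀ f w → StrictlyIncreasingOn f w → peakBits (map f w) ≡ peakBits w
peakBits-relabel f (a ∷ b ∷ c ∷ w) inc =
  cong₂ _∷_ (cong₂ _∧_ (<ᵇ-relabel f _ inc (here refl) (there (here refl)))
                       (<ᵇ-relabel f _ inc (there (there (here refl))) (there (here refl))))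
            (peakBits-relabel f (b ∷ c ∷ w) (λ p q → inc (there p) (there q)))
peakBits-relabel f []           _ = refl
peakBits-relabel f (a ∷ [])     _ = refl
peakBits-relabel f (a ∷ b ∷ []) _ = refl

peakComp-relabel : ∀ f w → StrictlyIncreasingOn f w → peakComp (map f w) ≡ peakComp w
peakComp-relabel f []          _   = refl
peakComp-relabel f (a ∷ [])    _   = refl
peakComp-relabel f (a ∷ b ∷ w) inc = begin
  peakComp (f a ∷ f b ∷ map f w)                   ≡⟨ peakComp-bits (f a) (f b) (map f w) ⟩
  compOfBits 1 (peakBits (map f (a ∷ b ∷ w)))      ≡⟨ cong (compOfBits 1) (peakBits-relabel f (a ∷ b ∷ w) inc) ⟩
  compOfBits 1 (peakBits (a ∷ b ∷ w))              ≡⟨ sym (peakComp-bits a b w) ⟩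
  peakComp (a ∷ b ∷ w)                             ∎
  where open ≡-Reasoning

lastPair : List ℕ → ℕ × ℕ
lastPair (a ∷ b ∷ [])    = a , b
lastPair (a ∷ b ∷ c ∷ w) = lastPair (b ∷ c ∷ w)
lastPair _               = 0 , 0

junctionBits : List ℕ → ℕ → ℕ → List Bool
junctionBits u v₁ v₂ = isPeak (proj₁ (lastPair u)) (proj₂ (lastPair u)) v₁
                     ∷ isPeak (proj₂ (lastPair u)) v₁ v₂ ∷ []

peakBits-++ : ∀ a b w v₁ v₂ v → peakBits ((a ∷ b ∷ w) ++ v₁ ∷ v₂ ∷ v) ≡
  peakBits (a ∷ b ∷ w) ++ junctionBits (a ∷ b ∷ w) v₁ v₂ ++ peakBits (v₁ ∷ v₂ ∷ v)
peakBits-++ a b []      v₁ v₂ v = refl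
peakBits-++ a b (c ∷ w) v₁ v₂ v = cong (isPeak a b c ∷_) (peakBits-++ b c w v₁ v₂ v)

blocks-++ : ∀ acc xs ys → blocks acc (xs ++ ys) ≡ blocks acc xs ++ blocks (openBlock acc xs) ys
blocks-++ acc []           ys = refl
blocks-++ acc (true  ∷ xs) ys = cong (suc acc ∷_) (blocks-++ 0 xs ys)
blocks-++ acc (false ∷ xs) ys = blocks-++ (suc acc) xs ys

openBlock-++ : ∀ acc xs ys → openBlock acc (xs ++ ys) ≡ openBlock (openBlock acc xs) ys
openBlock-++ acc []           ys = refl
openBlock-++ acc (true  ∷ xs) ys = openBlock-++ 0 xs ys
openBlock-++ acc (false ∷ xs) ys = openBlock-++ (suc acc) xs ys

compOfBits-++ : ∀ acc xs ys → compOfBits acc (xs ++ ys) ≡ blocks acc xs ++ compOfBits (openBlock acc xs) ys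
compOfBits-++ acc xs ys rewrite blocks-++ acc xs ys | openBlock-++ acc xs ys =
  ++-assoc (blocks acc xs) (blocks (openBlock acc xs) ys) _

peakComp-++ : ∀ a b w v₁ v₂ v → peakComp ((a ∷ b ∷ w) ++ v₁ ∷ v₂ ∷ v) ≡
  blocks 1 (peakBits (a ∷ b ∷ w)) ++
  compOfBits (openBlock 1 (peakBits (a ∷ b ∷ w))) (junctionBits (a ∷ b ∷ w) v₁ v₂ ++ peakBits (v₁ ∷ v₂ ∷ v))
peakComp-++ a b w v₁ v₂ v = begin
  peakComp (a ∷ b ∷ (w ++ v₁ ∷ v₂ ∷ v))        ≡⟨ peakComp-bits a b (w ++ v₁ ∷ v₂ ∷ v) ⟩
  compOfBits 1 (peakBits (a ∷ b ∷ (w ++ v₁ ∷ v₂ ∷ v)))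
                                                ≡⟨ cong (compOfBits 1) (peakBits-++ a b w v₁ v₂ v) ⟩
  compOfBits 1 (peakBits (a ∷ b ∷ w) ++ _)      ≡⟨ compOfBits-++ 1 (peakBits (a ∷ b ∷ w)) _ ⟩
  _                                             ∎
  where open ≡-Reasoning

compOfBits-head : ∀ acc bs → ∃₂ λ z Z → compOfBits acc bs ≡ z ∷ Z × acc < z
compOfBits-head acc []           = acc + 1 , [] , refl , subst (acc <_) (+-comm 1 acc) ≤-refl
compOfBits-head acc (true  ∷ bs) = suc acc , _ , refl , ≤-refl
compOfBits-head acc (false ∷ bs) with compOfBits-head (suc acc) bs
... | z , Z , e , acc<z = z , Z , e , <-trans (n<1+n acc) acc<z

compOfBits-closes : ∀ acc bs B → compOfBits acc bs ≡ suc acc ∷ B → B ≢ [] →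
  ∃ λ rest → bs ≡ true ∷ rest × compOfBits 0 rest ≡ B
compOfBits-closes acc []           B e B≢[] = ⊥-elim (B≢[] (sym (∷-injectiveʳ e)))
compOfBits-closes acc (true  ∷ bs) B e _    = bs , refl , ∷-injectiveʳ e
compOfBits-closes acc (false ∷ bs) B e _ with compOfBits-head (suc acc) bs
... | z , Z , e′ , lt = ⊥-elim (<⇒≢ lt (sym (∷-injectiveˡ (trans (sym e′) e))))

compOfBits-three : ∀ x y bs B → compOfBits 0 (x ∷ y ∷ bs) ≡ 3 ∷ B → B ≢ [] →
  ∃ λ rest → bs ≡ true ∷ rest × compOfBits 0 rest ≡ B
compOfBits-three true  y     bs B () _
compOfBits-three false true  bs B () _
compOfBits-three false false bs B e  B≢[] = compOfBits-closes 2 bs B e B≢[]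

sum-blocks : ∀ acc bs → sum (blocks acc bs) + openBlock acc bs ≡ acc + length bs
sum-blocks acc []           = sym (+-identityʳ acc)
sum-blocks acc (true  ∷ bs) = begin
  suc acc + sum (blocks 0 bs) + openBlock 0 bs   ≡⟨ +-assoc (suc acc) _ _ ⟩
  suc acc + (sum (blocks 0 bs) + openBlock 0 bs) ≡⟨ cong (suc acc +_) (sum-blocks 0 bs) ⟩
  suc acc + length bs                            ≡⟨ sym (+-suc acc (length bs)) ⟩
  acc + suc (length bs)                          ∎
  where open ≡-Reasoning
sum-blocks acc (false ∷ bs) = trans (sum-blocks (suc acc) bs) (sym (+-suc acc (length bs)))

blocks-positive : ∀ acc bs → IsComposition (blocks acc bs)
blocks-positive acc []           = []
blocks-positive acc (true  ∷ bs) = s≤s z≤n ∷ blocks-positive 0 bs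
blocks-positive acc (false ∷ bs) = blocks-positive (suc acc) bs

composition-prefix : ∀ X A z Z W R → IsComposition X → IsComposition A → X ++ z ∷ Z ≡ A ++ W →
  sum X + R ≡ sum A → R < z → X ≡ A × R ≡ 0 × z ∷ Z ≡ W
composition-prefix [] [] z Z W R _ _ eq s _ = refl , s , eq
composition-prefix [] (a ∷ A) z Z W R _ _ eq s R<z with ∷-injectiveˡ eq
... | refl = ⊥-elim (<⇒≱ R<z (subst (z ≤_) (sym s) (m≤m+n z (sum A))))
composition-prefix (x ∷ X) [] z Z W R (0<x ∷ _) _ eq s _ =
  ⊥-elim (<⇒≢ 0<x (sym (m+n≡0⇒m≡0 x (trans (sym (+-assoc x (sum X) R)) s))))
composition-prefix (x ∷ X) (a ∷ A) z Z W R (_ ∷ pX) (_ ∷ pA) eq s R<z with ∷-injectiveˡ eq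
... | refl with composition-prefix X A z Z W R pX pA (∷-injectiveʳ eq)
                  (+-cancelˡ-≡ x _ _ (trans (sym (+-assoc x (sum X) R)) s)) R<z
... | X≡A , R≡0 , rest = cong (x ∷_) X≡A , R≡0 , rest

sum≡0⇒[] : ∀ (A : Composition) → IsComposition A → sum A ≡ 0 → A ≡ []
sum≡0⇒[] []      _         _ = refl
sum≡0⇒[] (x ∷ A) (0<x ∷ _) e = ⊥-elim (<⇒≢ 0<x (sym (m+n≡0⇒m≡0 x e)))

[]≢∷ʳ : ∀ (A : Composition) x → [] ≢ A ++ [ x ]
[]≢∷ʳ []      x ()
[]≢∷ʳ (_ ∷ _) x ()

ends-descending : ∀ a b c w acc → openBlock acc (peakBits (a ∷ b ∷ c ∷ w)) ≡ 0 →
  (proj₂ (lastPair (a ∷ b ∷ c ∷ w)) <ᵇ proj₁ (lastPair (a ∷ b ∷ c ∷ w))) ≡ true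
ends-descending a b c [] acc e with a <ᵇ b | c <ᵇ b
... | true  | true  = refl
... | true  | false = ⊥-elim (0≢1+n (sym e))
... | false | _     = ⊥-elim (0≢1+n (sym e))
ends-descending a b c (d ∷ w) acc e with isPeak a b c
... | true  = ends-descending b c d w 0 e
... | false = ends-descending b c d w (suc acc) e

starts-with-two : ∀ v B → peakComp v ≡ 2 ∷ B → B ≢ [] →
  ∃₂ λ v₁ v₂ → ∃ λ v′ → v ≡ v₁ ∷ v₂ ∷ v′ × (v₁ <ᵇ v₂) ≡ true ×
    ∃ λ rest → peakBits v ≡ true ∷ rest × compOfBits 0 rest ≡ B
starts-with-two (v₁ ∷ v₂ ∷ v′) B e B≢[]
  with compOfBits-closes 1 (peakBits (v₁ ∷ v₂ ∷ v′)) B (trans (sym (peakComp-bits v₁ v₂ v′)) e) B≢[]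
starts-with-two (v₁ ∷ v₂ ∷ v₃ ∷ v″) B e B≢[] | rest , bits , rest-comp with v₁ <ᵇ v₂ in ascent
... | true  = v₁ , v₂ , v₃ ∷ v″ , refl , ascent , rest , bits , rest-comp
... | false with () ← ∷-injectiveˡ bits
starts-with-two (v₁ ∷ v₂ ∷ []) B e B≢[] | rest , () , _
starts-with-two []             B () _
starts-with-two (v₁ ∷ [])      B () _

peakComp-starting-peak : ∀ v₁ v₂ v′ {rest B} → peakBits (v₁ ∷ v₂ ∷ v′) ≡ true ∷ rest → compOfBits 0 rest ≡ B →
  peakComp (v₁ ∷ v₂ ∷ v′) ≡ 2 ∷ B
peakComp-starting-peak v₁ v₂ v′ bits rest-comp =
  trans (peakComp-bits v₁ v₂ v′) (trans (cong (compOfBits 1) bits) (cong (2 ∷_) rest-comp))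

-- The cut lemma, backward direction: if u has peak-composition A ⊕ (1) (it
-- ends with a descent) and v has peak-composition (2) ⊕ B (it starts with an
-- ascent), then neither junction letter is a peak and u ⊕ v has A ⊕ (3) ⊕ B.
cut-at-3⇐ : ∀ A B u v → B ≢ [] → peakComp u ≡ A ++ [ 1 ] → peakComp v ≡ 2 ∷ B →
  peakComp (u ++ v) ≡ A ++ 3 ∷ B
cut-at-3⇐ A B u v B≢[] eu ev with starts-with-two v B ev B≢[]
cut-at-3⇐ A B [] v B≢[] eu ev | _ = ⊥-elim ([]≢∷ʳ A 1 eu)
cut-at-3⇐ A B (u₁ ∷ []) v B≢[] eu ev | v₁ , v₂ , v′ , refl , ascent , rest , bits , rest-comp
  with ∷ʳ-injective [] A eu
... | refl , _ = begin
    peakComp (u₁ ∷ v₁ ∷ v₂ ∷ v′)                                ≡⟨ peakComp-bits u₁ v₁ (v₂ ∷ v′) ⟩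
    compOfBits 1 (isPeak u₁ v₁ v₂ ∷ peakBits (v₁ ∷ v₂ ∷ v′))    ≡⟨ cong₂ (λ x r → compOfBits 1 (x ∷ r)) no-peak bits ⟩
    3 ∷ compOfBits 0 rest                                        ≡⟨ cong (3 ∷_) rest-comp ⟩
    3 ∷ B                                                        ∎
  where
  open ≡-Reasoning
  no-peak : isPeak u₁ v₁ v₂ ≡ false
  no-peak = trans (cong ((u₁ <ᵇ v₁) ∧_) (<ᵇ-asym v₁ v₂ ascent)) (∧-false _)
cut-at-3⇐ A B (a ∷ b ∷ []) v B≢[] eu ev | _ = ⊥-elim (1+n≢n {1} (proj₂ (∷ʳ-injective [] A eu)))
cut-at-3⇐ A B (a ∷ b ∷ c ∷ w) v B≢[] eu ev | v₁ , v₂ , v′ , refl , ascent , rest , bits , rest-comp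
  with ∷ʳ-injective (blocks 1 (peakBits u)) A (trans (sym (peakComp-bits a b (c ∷ w))) eu)
  where u = a ∷ b ∷ c ∷ w
... | blocks≡A , open+1≡1 = begin
    peakComp (u ++ v₁ ∷ v₂ ∷ v′)
      ≡⟨ peakComp-++ a b (c ∷ w) v₁ v₂ v′ ⟩
    blocks 1 (peakBits u) ++ compOfBits (openBlock 1 (peakBits u)) (junctionBits u v₁ v₂ ++ peakBits (v₁ ∷ v₂ ∷ v′))
      ≡⟨ cong₂ (λ X o → X ++ compOfBits o (junctionBits u v₁ v₂ ++ peakBits (v₁ ∷ v₂ ∷ v′))) blocks≡A open≡0 ⟩
    A ++ compOfBits 0 (junctionBits u v₁ v₂ ++ peakBits (v₁ ∷ v₂ ∷ v′))
      ≡⟨ cong (λ r → A ++ compOfBits 0 r) (cong₂ _∷_ no-peak₁ (cong₂ _∷_ no-peak₂ bits)) ⟩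
    A ++ 3 ∷ compOfBits 0 rest
      ≡⟨ cong (λ z → A ++ 3 ∷ z) rest-comp ⟩
    A ++ 3 ∷ B ∎
  where
  open ≡-Reasoning
  u = a ∷ b ∷ c ∷ w
  p = proj₁ (lastPair u)
  q = proj₂ (lastPair u)
  open≡0 : openBlock 1 (peakBits u) ≡ 0
  open≡0 = +-cancelʳ-≡ 1 _ 0 open+1≡1
  no-peak₁ : isPeak p q v₁ ≡ false
  no-peak₁ = cong (_∧ (v₁ <ᵇ q)) (<ᵇ-asym q p (ends-descending a b c w 1 open≡0))
  no-peak₂ : isPeak q v₁ v₂ ≡ false
  no-peak₂ = trans (cong ((q <ᵇ v₁) ∧_) (<ᵇ-asym v₁ v₂ ascent)) (∧-false _)

-- The cut lemma, forward direction: if u ⊕ v has peak-composition A ⊕ (3) ⊕ B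
-- and u has length |A|+1, then the parts of A are exactly the completed parts
-- of u, u ends one letter after its last peak, and the part 3 straddles the
-- junction, forcing v to start with an ascent and a peak.
cut-at-3⇒ : ∀ A B u v → IsComposition A → B ≢ [] → length u ≡ sum A + 1 → 2 ≤ length v →
  peakComp (u ++ v) ≡ A ++ 3 ∷ B → peakComp u ≡ A ++ [ 1 ] × peakComp v ≡ 2 ∷ B
cut-at-3⇒ A B u []       _ _ _ () _
cut-at-3⇒ A B u (_ ∷ []) _ _ _ (s≤s ()) _
cut-at-3⇒ A B [] v _ _ len _ _ = ⊥-elim (0≢1+n (trans len (+-comm (sum A) 1)))
cut-at-3⇒ A B (u₁ ∷ []) (v₁ ∷ v₂ ∷ v′) pA B≢[] len _ e
  with sum≡0⇒[] A pA (sym (+-cancelʳ-≡ 1 0 (sum A) len))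
... | refl with compOfBits-three false (isPeak u₁ v₁ v₂) (peakBits (v₁ ∷ v₂ ∷ v′)) B
                  (trans (sym (peakComp-bits u₁ v₁ (v₂ ∷ v′))) e) B≢[]
... | rest , bits , rest-comp =
  refl , peakComp-starting-peak v₁ v₂ v′ bits rest-comp
cut-at-3⇒ A B (a ∷ b ∷ w) (v₁ ∷ v₂ ∷ v′) pA B≢[] len _ e
  with compOfBits-head (openBlock 1 (peakBits u)) (junctionBits u v₁ v₂ ++ peakBits (v₁ ∷ v₂ ∷ v′))
  where u = a ∷ b ∷ w
... | z , Z , head , open<z
  with composition-prefix (blocks 1 (peakBits u)) A z Z (3 ∷ B) (openBlock 1 (peakBits u))
         (blocks-positive 1 (peakBits u)) pA
         (trans (cong (blocks 1 (peakBits u) ++_) (sym head)) (trans (sym (peakComp-++ a b w v₁ v₂ v′)) e))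
         sizes open<z
  where
  u = a ∷ b ∷ w
  sizes : sum (blocks 1 (peakBits u)) + openBlock 1 (peakBits u) ≡ sum A
  sizes = trans (sum-blocks 1 (peakBits u))
            (trans (cong suc (length-peakBits a b w)) (suc-injective (trans len (+-comm (sum A) 1))))
... | blocks≡A , open≡0 , rest-eq
  with compOfBits-three (isPeak (proj₁ (lastPair (a ∷ b ∷ w))) (proj₂ (lastPair (a ∷ b ∷ w))) v₁)
                        (isPeak (proj₂ (lastPair (a ∷ b ∷ w))) v₁ v₂) (peakBits (v₁ ∷ v₂ ∷ v′)) B
         (trans (cong (λ o → compOfBits o (junctionBits (a ∷ b ∷ w) v₁ v₂ ++ peakBits (v₁ ∷ v₂ ∷ v′))) (sym open≡0))
                (trans head rest-eq)) B≢[]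
... | rest , bits , rest-comp =
  trans (peakComp-bits a b w) (cong₂ (λ X o → X ++ [ o + 1 ]) blocks≡A open≡0) ,
  peakComp-starting-peak v₁ v₂ v′ bits rest-comp

-- Bit vectors: rank and select.  A bit vector bs of length n marks which
-- values of [n] are used by the first part of a cut permutation.

-- Bit at 0-based position v (false beyond the end).
bitAt : List Bool → ℕ → Bool
bitAt []       _       = false
bitAt (x ∷ _)  zero    = x
bitAt (_ ∷ bs) (suc v) = bitAt bs v

trues : List Bool → ℕ
trues []           = 0
trues (true  ∷ bs) = suc (trues bs)
trues (false ∷ bs) = trues bs

-- Position of the i-th true bit (0-based).
select : List Bool → ℕ → ℕ
select []           i       = 0
select (true  ∷ bs) zero    = 0
select (true  ∷ bs) (suc i) = suc (select bs i)
select (false ∷ bs) i       = suc (select bs i)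

rank : List Bool → ℕ → ℕ
rank []           v       = 0
rank (x ∷ bs)     zero    = 0
rank (true  ∷ bs) (suc v) = suc (rank bs v)
rank (false ∷ bs) (suc v) = rank bs v

select-<length : ∀ bs i → i < trues bs → select bs i < length bs
select-<length (true  ∷ bs) zero    _         = s≤s z≤n
select-<length (true  ∷ bs) (suc i) (s≤s i<t) = s≤s (select-<length bs i i<t)
select-<length (false ∷ bs) i       i<t       = s≤s (select-<length bs i i<t)

select-true : ∀ bs i → i < trues bs → bitAt bs (select bs i) ≡ true
select-true (true  ∷ bs) zero    _         = refl
select-true (true  ∷ bs) (suc i) (s≤s i<t) = select-true bs i i<t
select-true (false ∷ bs) i       i<t       = select-true bs i i<t

rank-select : ∀ bs i → i < trues bs → rank bs (select bs i) ≡ i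
rank-select (true  ∷ bs) zero    _         = refl
rank-select (true  ∷ bs) (suc i) (s≤s i<t) = cong suc (rank-select bs i i<t)
rank-select (false ∷ bs) i       i<t       = rank-select bs i i<t

rank-<trues : ∀ bs v → bitAt bs v ≡ true → rank bs v < trues bs
rank-<trues (true  ∷ bs) zero    _ = s≤s z≤n
rank-<trues (false ∷ bs) zero    ()
rank-<trues (true  ∷ bs) (suc v) b = s≤s (rank-<trues bs v b)
rank-<trues (false ∷ bs) (suc v) b = rank-<trues bs v b

select-rank : ∀ bs v → bitAt bs v ≡ true → select bs (rank bs v) ≡ v
select-rank (true  ∷ bs) zero    _ = refl
select-rank (false ∷ bs) zero    ()
select-rank (true  ∷ bs) (suc v) b = cong suc (select-rank bs v b)
select-rank (false ∷ bs) (suc v) b = cong suc (select-rank bs v b)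

rank-monotone : ∀ bs v w → v ≤ w → rank bs v ≤ rank bs w
rank-monotone []           v       w       _         = z≤n
rank-monotone (x ∷ bs)     zero    w       _         = z≤n
rank-monotone (true  ∷ bs) (suc v) (suc w) (s≤s v≤w) = s≤s (rank-monotone bs v w v≤w)
rank-monotone (false ∷ bs) (suc v) (suc w) (s≤s v≤w) = rank-monotone bs v w v≤w

rank-strict : ∀ bs v w → v < w → bitAt bs v ≡ true → rank bs v < rank bs w
rank-strict (true  ∷ bs) zero    (suc w) _         _ = s≤s z≤n
rank-strict (false ∷ bs) zero    (suc w) _         ()
rank-strict (true  ∷ bs) (suc v) (suc w) (s≤s v<w) b = s≤s (rank-strict bs v w v<w b)
rank-strict (false ∷ bs) (suc v) (suc w) (s≤s v<w) b = rank-strict bs v w v<w b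

-- Select is strictly increasing, being a section of the monotone rank.
select-strict : ∀ bs i j → i < j → j < trues bs → select bs i < select bs j
select-strict bs i j i<j j<t with <-cmp (select bs i) (select bs j)
... | tri< lt _ _ = lt
... | tri≈ _ e _  = ⊥-elim (<⇒≢ i<j (trans (sym (rank-select bs i (<-trans i<j j<t)))
                                            (trans (cong (rank bs) e) (rank-select bs j j<t))))
... | tri> _ _ gt = ⊥-elim (<⇒≱ i<j (subst₂ _≤_ (rank-select bs j j<t) (rank-select bs i (<-trans i<j j<t))
                                                 (rank-monotone bs _ _ (<⇒≤ gt))))

bitAt-not : ∀ bs v → v < length bs → bitAt (map not bs) v ≡ not (bitAt bs v)
bitAt-not (x ∷ bs) zero    _         = refl
bitAt-not (x ∷ bs) (suc v) (s≤s v<n) = bitAt-not bs v v<n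

trues+trues-not : ∀ bs → trues bs + trues (map not bs) ≡ length bs
trues+trues-not []           = refl
trues+trues-not (true  ∷ bs) = cong suc (trues+trues-not bs)
trues+trues-not (false ∷ bs) = trans (+-suc (trues bs) _) (cong suc (trues+trues-not bs))

bitAt-tabulate : ∀ (f : ℕ → Bool) n j → j < n → bitAt (map f (upTo n)) j ≡ f j
bitAt-tabulate f (suc n) zero    _         = refl
bitAt-tabulate f (suc n) (suc j) (s≤s j<n) =
  trans (cong (λ l → bitAt l j) (trans (cong (map f) (sym (map-upTo suc n))) (sym (map-∘ (upTo n)))))
        (bitAt-tabulate (λ x → f (suc x)) n j j<n)

tabulate-bitAt : ∀ bs → map (bitAt bs) (upTo (length bs)) ≡ bs
tabulate-bitAt []       = refl
tabulate-bitAt (x ∷ bs) = cong (x ∷_) (trans (cong (map (bitAt (x ∷ bs))) (sym (map-upTo suc (length bs))))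
                                      (trans (sym (map-∘ (upTo (length bs)))) (tabulate-bitAt bs)))

trues-tabulate : ∀ {Q : ℕ → Set} (Q? : Decidable Q) xs → trues (map (λ j → does (Q? j)) xs) ≡ length (filter Q? xs)
trues-tabulate Q? []       = refl
trues-tabulate Q? (x ∷ xs) with does (Q? x)
... | true  = cong suc (trues-tabulate Q? xs)
... | false = trues-tabulate Q? xs

shuffles : ℕ → ℕ → List (List Bool)
shuffles zero    zero    = [ [] ]
shuffles (suc p) zero    = map (true ∷_) (shuffles p zero)
shuffles zero    (suc r) = map (false ∷_) (shuffles zero r)
shuffles (suc p) (suc r) = map (true ∷_) (shuffles p (suc r)) ++ map (false ∷_) (shuffles (suc p) r)

∈shuffles⁺ : ∀ bs → bs ∈ shuffles (trues bs) (trues (map not bs))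
∈shuffles⁺ [] = here refl
∈shuffles⁺ (true ∷ bs) with trues (map not bs) | ∈shuffles⁺ bs
... | zero  | q = ∈-map⁺ (true ∷_) q
... | suc r | q = ∈-++⁺ˡ (∈-map⁺ (true ∷_) q)
∈shuffles⁺ (false ∷ bs) with trues bs | ∈shuffles⁺ bs
... | zero  | q = ∈-map⁺ (false ∷_) q
... | suc p | q = ∈-++⁺ʳ _ (∈-map⁺ (false ∷_) q)

∈shuffles⁻ : ∀ p r bs → bs ∈ shuffles p r → trues bs ≡ p × trues (map not bs) ≡ r
∈shuffles⁻ zero zero .[] (here refl) = refl , refl
∈shuffles⁻ (suc p) zero bs q with ∈-map⁻ (true ∷_) q
... | bs′ , q′ , refl = map₁ (cong suc) (∈shuffles⁻ p zero bs′ q′)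
∈shuffles⁻ zero (suc r) bs q with ∈-map⁻ (false ∷_) q
... | bs′ , q′ , refl = map₂ (cong suc) (∈shuffles⁻ zero r bs′ q′)
∈shuffles⁻ (suc p) (suc r) bs q with ∈-++⁻ (map (true ∷_) (shuffles p (suc r))) q
... | inj₁ q₁ with ∈-map⁻ (true ∷_) q₁
...   | bs′ , q′ , refl = map₁ (cong suc) (∈shuffles⁻ p (suc r) bs′ q′)
∈shuffles⁻ (suc p) (suc r) bs q | inj₂ q₂ with ∈-map⁻ (false ∷_) q₂
...   | bs′ , q′ , refl = map₂ (cong suc) (∈shuffles⁻ (suc p) r bs′ q′)

shuffles-unique : ∀ p r → Unique (shuffles p r)
shuffles-unique zero    zero    = [] ∷ []
shuffles-unique (suc p) zero    = Unique.map⁺ ∷-injectiveʳ (shuffles-unique p zero)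
shuffles-unique zero    (suc r) = Unique.map⁺ ∷-injectiveʳ (shuffles-unique zero r)
shuffles-unique (suc p) (suc r) =
  Unique.++⁺ (Unique.map⁺ ∷-injectiveʳ (shuffles-unique p (suc r)))
             (Unique.map⁺ ∷-injectiveʳ (shuffles-unique (suc p) r)) disjoint
  where
  disjoint : ∀ {v} → v ∈ map (true ∷_) (shuffles p (suc r)) × v ∈ map (false ∷_) (shuffles (suc p) r) → ⊥
  disjoint (a , b) with ∈-map⁻ (true ∷_) a | ∈-map⁻ (false ∷_) b
  ... | _ , _ , refl | _ , _ , ()

-- The binomial coefficient C(p+r, p), as the number of shuffles.
binomial : ℕ → ℕ → ℕ
binomial p r = length (shuffles p r)

binomial-p-0 : ∀ p → binomial p 0 ≡ 1
binomial-p-0 zero    = refl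
binomial-p-0 (suc p) = trans (length-map (true ∷_) (shuffles p zero)) (binomial-p-0 p)

binomial-0-r : ∀ r → binomial 0 r ≡ 1
binomial-0-r zero    = refl
binomial-0-r (suc r) = trans (length-map (false ∷_) (shuffles zero r)) (binomial-0-r r)

-- C(p+r, p) · p! · r! = (p+r)!, by Pascal's rule.
binomial-factorials : ∀ p r → binomial p r * (p ! * r !) ≡ (p + r) !
binomial-factorials zero zero = refl
binomial-factorials (suc p) zero rewrite binomial-p-0 (suc p) | +-identityʳ p = trans (+-identityʳ _) (*-identityʳ _)
binomial-factorials zero (suc r) rewrite binomial-0-r (suc r) = trans (*-identityˡ _) (*-identityˡ _)
binomial-factorials (suc p) (suc r) = begin
    length (map (true ∷_) (shuffles p (suc r)) ++ map (false ∷_) (shuffles (suc p) r)) * (suc p ! * suc r !)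
  ≡⟨ cong (_* (suc p ! * suc r !)) (trans (length-++ (map (true ∷_) (shuffles p (suc r))))
       (cong₂ _+_ (length-map (true ∷_) (shuffles p (suc r))) (length-map (false ∷_) (shuffles (suc p) r)))) ⟩
    (L₁ + L₂) * (suc p ! * suc r !)
  ≡⟨ distribute L₁ L₂ (suc p) (suc r) (p !) (r !) ⟩
    suc p * (L₁ * (p ! * suc r !)) + suc r * (L₂ * (suc p ! * r !))
  ≡⟨ cong₂ (λ a b → suc p * a + suc r * b) (binomial-factorials p (suc r)) (binomial-factorials (suc p) r) ⟩
    suc p * (p + suc r) ! + suc r * (suc p + r) !
  ≡⟨ cong (λ z → suc p * z ! + suc r * (suc p + r) !) (+-suc p r) ⟩
    suc p * (suc p + r) ! + suc r * (suc p + r) !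
  ≡⟨ sym (*-distribʳ-+ ((suc p + r) !) (suc p) (suc r)) ⟩
    (suc p + suc r) * (suc p + r) !
  ≡⟨ cong (λ z → (suc p + suc r) * z !) (sym (+-suc p r)) ⟩
    (suc p + suc r) ! ∎
  where
  open ≡-Reasoning
  L₁ = binomial p (suc r)
  L₂ = binomial (suc p) r
  distribute : ∀ a b x y fx fy → (a + b) * ((x * fx) * (y * fy)) ≡ x * (a * (fx * (y * fy))) + y * (b * ((x * fx) * fy))
  distribute = solve-∀

-- Embedding and standardisation.  The values of [n] marked by a bit vector bs
-- are listed increasingly by `embed bs`; `standardise bs` is its inverse.

embed : List Bool → ℕ → ℕ
embed bs i = suc (select bs (pred i))

standardise : List Bool → ℕ → ℕ
standardise bs v = suc (rank bs (pred v))

Marked : List Bool → ℕ → Set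
Marked bs v = InRange (length bs) v × bitAt bs (pred v) ≡ true

module EmbedPermutation (bs : List Bool) (α : List ℕ) (α∈ : α ∈ perms (trues bs)) where

  private
    α-letters : All (InRange (trues bs)) α
    α-letters = proj₁ (proj₂ (∈perms⁻ (trues bs) α α∈))

    pred<trues : ∀ {x} → x ∈ α → pred x < trues bs
    pred<trues x∈ = pred<-InRange (All.lookup α-letters x∈)

    standardise-embed-letter : ∀ {x} → x ∈ α → standardise bs (embed bs x) ≡ x
    standardise-embed-letter x∈ =
      trans (cong suc (rank-select bs _ (pred<trues x∈))) (suc-pred-InRange (All.lookup α-letters x∈))

  embed-marked : ∀ {y} → y ∈ map (embed bs) α → Marked bs y
  embed-marked y∈ with ∈-map⁻ (embed bs) y∈
  ... | x , x∈ , refl = (s≤s z≤n , select-<length bs _ (pred<trues x∈)) , select-true bs _ (pred<trues x∈)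

  embed-unique : Unique (map (embed bs) α)
  embed-unique = map-unique (embed bs) α (proj₂ (proj₂ (∈perms⁻ (trues bs) α α∈)))
    (λ p q e → trans (sym (standardise-embed-letter p)) (trans (cong (standardise bs) e) (standardise-embed-letter q)))

  embed-peakComp : peakComp (map (embed bs) α) ≡ peakComp α
  embed-peakComp = peakComp-relabel (embed bs) α increasing
    where
    increasing : StrictlyIncreasingOn (embed bs) α
    increasing {suc x} {suc y} _ q (s≤s x<y) = s≤s (select-strict bs x y x<y (pred<trues q))
    increasing {zero}          p _ _         = ⊥-elim (<-irrefl refl (proj₁ (All.lookup α-letters p)))

  standardise-embed : map (standardise bs) (map (embed bs) α) ≡ α
  standardise-embed = trans (sym (map-∘ α)) (map-id-local (All.tabulate standardise-embed-letter))

  embed-covers : ∀ j → bitAt bs j ≡ true → suc j ∈ map (embed bs) α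
  embed-covers j b = subst (_∈ map (embed bs) α) (cong suc (select-rank bs j b))
    (∈-map⁺ (embed bs) (perm-covers (trues bs) α α∈ (suc (rank bs j)) (s≤s z≤n , rank-<trues bs j b)))

module StandardiseWord (bs : List Bool) (T : List ℕ) (T-unique : Unique T)
                       (T-marked : ∀ {x} → x ∈ T → Marked bs x) where

  private
    embed-standardise-letter : ∀ {x} → x ∈ T → embed bs (standardise bs x) ≡ x
    embed-standardise-letter x∈ =
      trans (cong suc (select-rank bs _ (proj₂ (T-marked x∈)))) (suc-pred-InRange (proj₁ (T-marked x∈)))

  standardise-letters : All (InRange (trues bs)) (map (standardise bs) T)
  standardise-letters = All.map⁺ (All.tabulate (λ x∈ → s≤s z≤n , rank-<trues bs _ (proj₂ (T-marked x∈))))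

  standardise-unique : Unique (map (standardise bs) T)
  standardise-unique = map-unique (standardise bs) T T-unique
    (λ p q e → trans (sym (embed-standardise-letter p)) (trans (cong (embed bs) e) (embed-standardise-letter q)))

  standardise-peakComp : peakComp (map (standardise bs) T) ≡ peakComp T
  standardise-peakComp = peakComp-relabel (standardise bs) T increasing
    where
    increasing : StrictlyIncreasingOn (standardise bs) T
    increasing {suc x} {suc y} p _ (s≤s x<y) = s≤s (rank-strict bs x y x<y (proj₂ (T-marked p)))
    increasing {zero}          p _ _         = ⊥-elim (<-irrefl refl (proj₁ (proj₁ (T-marked p))))

  embed-standardise : map (embed bs) (map (standardise bs) T) ≡ T
  embed-standardise = trans (sym (map-∘ T)) (map-id-local (All.tabulate embed-standardise-letter))

-- Suppose a permutation of [p+r] has peak-composition t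
-- exactly when its prefix of length p has t₁ and its suffix has t₂.  Then such
-- permutations correspond to triples (shuffle, permutation of [p] with t₁,
-- permutation of [r] with t₂): the shuffle records the values of the prefix.

withPeakComp : Composition → List (List ℕ) → List (List ℕ)
withPeakComp c = filter (λ σ → ≡-dec _≟_ (peakComp σ) c)

module CutBijection (p r : ℕ) (t t₁ t₂ : Composition)
  (cut⇒ : ∀ u v → length u ≡ p → length v ≡ r → peakComp (u ++ v) ≡ t → peakComp u ≡ t₁ × peakComp v ≡ t₂)
  (cut⇐ : ∀ u v → peakComp u ≡ t₁ → peakComp v ≡ t₂ → peakComp (u ++ v) ≡ t) where

  n : ℕ
  n = p + r

  Triple : Set
  Triple = List Bool × (List ℕ × List ℕ)

  cutPerms : List (List ℕ)
  cutPerms = withPeakComp t (perms n)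

  triples : List Triple
  triples = cartesianProduct (shuffles p r) (cartesianProduct (withPeakComp t₁ (perms p)) (withPeakComp t₂ (perms r)))

  merge : Triple → List ℕ
  merge (bs , α , β) = map (embed bs) α ++ map (embed (map not bs)) β

  prefixValues : List ℕ → List Bool
  prefixValues σ = map (λ j → does (suc j ∈? take p σ)) (upTo n)

  splitAlong : List Bool → List ℕ → Triple
  splitAlong bs σ = bs , map (standardise bs) (take p σ) , map (standardise (map not bs)) (drop p σ)

  split : List ℕ → Triple
  split σ = splitAlong (prefixValues σ) σ

  module Merge {bs α β} (τ∈ : (bs , α , β) ∈ triples) where

    private
      parts∈ = ∈-cartesianProduct⁻ (shuffles p r) _ τ∈
      perms∈ = ∈-cartesianProduct⁻ (withPeakComp t₁ (perms p)) (withPeakComp t₂ (perms r)) (proj₂ parts∈)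
      α∈ = ∈-filter⁻ (λ σ → ≡-dec _≟_ (peakComp σ) t₁) {xs = perms p} (proj₁ perms∈)
      β∈ = ∈-filter⁻ (λ σ → ≡-dec _≟_ (peakComp σ) t₂) {xs = perms r} (proj₂ perms∈)
      trues-bs = ∈shuffles⁻ p r bs (proj₁ parts∈)

    length-bs : length bs ≡ n
    length-bs = trans (sym (trues+trues-not bs)) (cong₂ _+_ (proj₁ trues-bs) (proj₂ trues-bs))

    module Eα = EmbedPermutation bs α (subst (λ k → α ∈ perms k) (sym (proj₁ trues-bs)) (proj₁ α∈))
    module Eβ = EmbedPermutation (map not bs) β (subst (λ k → β ∈ perms k) (sym (proj₂ trues-bs)) (proj₁ β∈))

    u v : List ℕ
    u = map (embed bs) α
    v = map (embed (map not bs)) β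

    length-u : length u ≡ p
    length-u = trans (length-map _ α) (proj₁ (∈perms⁻ p α (proj₁ α∈)))

    length-v : length v ≡ r
    length-v = trans (length-map _ β) (proj₁ (∈perms⁻ r β (proj₁ β∈)))

    merge-letters : All (InRange n) (u ++ v)
    merge-letters = All.++⁺ (All.tabulate (λ q → subst (λ k → InRange k _) length-bs (proj₁ (Eα.embed-marked q))))
                            (All.tabulate (λ q → subst (λ k → InRange k _) (trans (length-map not bs) length-bs)
                                                        (proj₁ (Eβ.embed-marked q))))

    merge-unique : Unique (u ++ v)
    merge-unique = Unique.++⁺ Eα.embed-unique Eβ.embed-unique disjoint
      where
      disjoint : ∀ {y} → y ∈ u × y ∈ v → ⊥
      disjoint {y} (a , b) with () ← trans (sym (cong not (proj₂ (Eα.embed-marked a))))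
        (trans (sym (bitAt-not bs (pred y) (pred<-InRange (proj₁ (Eα.embed-marked a))))) (proj₂ (Eβ.embed-marked b)))

    merge-∈ : merge (bs , α , β) ∈ cutPerms
    merge-∈ = ∈-filter⁺ (λ σ → ≡-dec _≟_ (peakComp σ) t)
      (∈perms⁺ n (u ++ v) (trans (length-++ u) (cong₂ _+_ length-u length-v)) merge-letters merge-unique)
      (cut⇐ u v (trans Eα.embed-peakComp (proj₂ α∈)) (trans Eβ.embed-peakComp (proj₂ β∈)))

    take-merge : take p (u ++ v) ≡ u
    take-merge = subst (λ k → take k (u ++ v) ≡ u) length-u (take-length-++ u v)

    drop-merge : drop p (u ++ v) ≡ v
    drop-merge = subst (λ k → drop k (u ++ v) ≡ v) length-u (drop-length-++ u v)

    prefixValues-merge : prefixValues (u ++ v) ≡ bs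
    prefixValues-merge = begin
        map (λ j → does (suc j ∈? take p (u ++ v))) (upTo n)
      ≡⟨ map-cong-local (All.tabulate (λ {j} q → trans (cong (λ T → does (suc j ∈? T)) take-merge)
                                                       (marked-in-u j (∈-upTo⁻ q)))) ⟩
        map (bitAt bs) (upTo n)
      ≡⟨ cong (λ k → map (bitAt bs) (upTo k)) (sym length-bs) ⟩
        map (bitAt bs) (upTo (length bs))
      ≡⟨ tabulate-bitAt bs ⟩
        bs ∎
      where
      open ≡-Reasoning
      marked-in-u : ∀ j → j < n → does (suc j ∈? u) ≡ bitAt bs j
      marked-in-u j j<n with bitAt bs j in b
      ... | true  = dec-true (suc j ∈? u) (Eα.embed-covers j b)
      ... | false = dec-false (suc j ∈? u) not-in-u
        where
        not-in-u : suc j ∉ u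
        not-in-u q with () ← trans (sym b) (proj₂ (Eα.embed-marked q))

    split-merge : split (merge (bs , α , β)) ≡ (bs , α , β)
    split-merge = begin
        splitAlong (prefixValues (u ++ v)) (u ++ v)
      ≡⟨ cong (λ b → splitAlong b (u ++ v)) prefixValues-merge ⟩
        splitAlong bs (u ++ v)
      ≡⟨ cong₂ (λ T D → bs , map (standardise bs) T , map (standardise (map not bs)) D) take-merge drop-merge ⟩
        bs , map (standardise bs) u , map (standardise (map not bs)) v
      ≡⟨ cong₂ (λ a b → bs , a , b) Eα.standardise-embed Eβ.standardise-embed ⟩
        bs , α , β ∎
      where open ≡-Reasoning

  module Split {σ} (σ∈ : σ ∈ cutPerms) where

    private
      σ∈′ = ∈-filter⁻ (λ σ → ≡-dec _≟_ (peakComp σ) t) {xs = perms n} σ∈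
      σ-perm = ∈perms⁻ n σ (proj₁ σ∈′)
      σ-letters = proj₁ (proj₂ σ-perm)
      σ-unique = proj₂ (proj₂ σ-perm)

    T D : List ℕ
    T = take p σ
    D = drop p σ

    bs : List Bool
    bs = prefixValues σ

    T++D : T ++ D ≡ σ
    T++D = take++drop≡id p σ

    length-T : length T ≡ p
    length-T = trans (length-take p σ) (trans (cong (p ⊓_) (proj₁ σ-perm)) (m≤n⇒m⊓n≡m (m≤m+n p r)))

    length-D : length D ≡ r
    length-D = trans (length-drop p σ) (trans (cong (_∸ p) (proj₁ σ-perm)) (m+n∸m≡n p r))

    length-bs : length bs ≡ n
    length-bs = trans (length-map _ (upTo n)) (length-upTo n)

    T-letters : ∀ {x} → x ∈ T → InRange n x
    T-letters q = All.lookup σ-letters (subst (_ ∈_) T++D (∈-++⁺ˡ q))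

    D-letters : ∀ {x} → x ∈ D → InRange n x
    D-letters q = All.lookup σ-letters (subst (_ ∈_) T++D (∈-++⁺ʳ T q))

    bitAt-bs : ∀ {x} → InRange n x → bitAt bs (pred x) ≡ does (x ∈? T)
    bitAt-bs {x} x-in = trans (bitAt-tabulate (λ j → does (suc j ∈? T)) n (pred x) (pred<-InRange x-in))
                              (cong (λ z → does (z ∈? T)) (suc-pred-InRange x-in))

    T-marked : ∀ {x} → x ∈ T → Marked bs x
    T-marked q = subst (λ k → InRange k _) (sym length-bs) (T-letters q) , trans (bitAt-bs (T-letters q)) (dec-true (_ ∈? T) q)

    D-marked : ∀ {x} → x ∈ D → Marked (map not bs) x
    D-marked {x} q = subst (λ k → InRange k x) (sym (trans (length-map not bs) length-bs)) (D-letters q) ,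
      trans (bitAt-not bs (pred x) (subst (pred x <_) (sym length-bs) (pred<-InRange (D-letters q))))
            (cong not (trans (bitAt-bs (D-letters q)) (dec-false (x ∈? T) x∉T)))
      where
      x∉T : x ∉ T
      x∉T x∈T = unique-++-disjoint T D (subst Unique (sym T++D) σ-unique) x∈T q

    -- The marked positions are the predecessors of the letters of T.
    trues-bs : trues bs ≡ p
    trues-bs = begin
        trues bs
      ≡⟨ trues-tabulate (λ j → suc j ∈? T) (upTo n) ⟩
        length (filter (λ j → suc j ∈? T) (upTo n))
      ≡⟨ length-≡-bijection suc pred _ T (Unique.filter⁺ (λ j → suc j ∈? T) (Unique.upTo⁺ n)) T-unique
           (λ q → proj₂ (∈-filter⁻ (λ j → suc j ∈? T) {xs = upTo n} q)) (λ _ → refl)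
           (λ q → ∈-filter⁺ (λ j → suc j ∈? T) (∈-upTo⁺ (pred<-InRange (T-letters q)))
                    (subst (_∈ T) (sym (suc-pred-InRange (T-letters q))) q))
           (λ q → suc-pred-InRange (T-letters q)) ⟩
        length T
      ≡⟨ length-T ⟩
        p ∎
      where
      open ≡-Reasoning
      T-unique : Unique T
      T-unique = Unique.take⁺ p σ-unique

    trues-not-bs : trues (map not bs) ≡ r
    trues-not-bs = +-cancelˡ-≡ p _ _ (trans (cong (_+ trues (map not bs)) (sym trues-bs)) (trans (trues+trues-not bs) length-bs))

    module Sα = StandardiseWord bs T (Unique.take⁺ p σ-unique) T-marked
    module Sβ = StandardiseWord (map not bs) D (Unique.drop⁺ p σ-unique) D-marked

    peakComps : peakComp T ≡ t₁ × peakComp D ≡ t₂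
    peakComps = cut⇒ T D length-T length-D (subst (λ s → peakComp s ≡ t) (sym T++D) (proj₂ σ∈′))

    split-∈ : split σ ∈ triples
    split-∈ = ∈-cartesianProduct⁺ (subst₂ (λ a b → bs ∈ shuffles a b) trues-bs trues-not-bs (∈shuffles⁺ bs))
      (∈-cartesianProduct⁺
        (∈-filter⁺ (λ σ → ≡-dec _≟_ (peakComp σ) t₁)
          (∈perms⁺ p α (trans (length-map _ T) length-T)
                   (subst (λ k → All (InRange k) α) trues-bs Sα.standardise-letters) Sα.standardise-unique)
          (trans Sα.standardise-peakComp (proj₁ peakComps)))
        (∈-filter⁺ (λ σ → ≡-dec _≟_ (peakComp σ) t₂)
          (∈perms⁺ r β (trans (length-map _ D) length-D)
                   (subst (λ k → All (InRange k) β) trues-not-bs Sβ.standardise-letters) Sβ.standardise-unique)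
          (trans Sβ.standardise-peakComp (proj₂ peakComps))))
      where
      α = map (standardise bs) T
      β = map (standardise (map not bs)) D

    merge-split : merge (split σ) ≡ σ
    merge-split = trans (cong₂ _++_ Sα.embed-standardise Sβ.embed-standardise) T++D

  count : length cutPerms ≡ binomial p r * (length (withPeakComp t₁ (perms p)) * length (withPeakComp t₂ (perms r)))
  count = begin
      length cutPerms
    ≡⟨ length-≡-bijection split merge cutPerms triples
         (Unique.filter⁺ _ (perms-unique n))
         (Unique.cartesianProduct⁺ (shuffles-unique p r)
           (Unique.cartesianProduct⁺ (Unique.filter⁺ _ (perms-unique p)) (Unique.filter⁺ _ (perms-unique r))))
         Split.split-∈ Split.merge-split Merge.merge-∈ Merge.split-merge ⟩
      length triples
    ≡⟨ length-cartesianProduct (shuffles p r) _ ⟩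
      binomial p r * length (cartesianProduct (withPeakComp t₁ (perms p)) (withPeakComp t₂ (perms r)))
    ≡⟨ cong (binomial p r *_) (length-cartesianProduct (withPeakComp t₁ (perms p)) _) ⟩
      binomial p r * (length (withPeakComp t₁ (perms p)) * length (withPeakComp t₂ (perms r))) ∎
    where open ≡-Reasoning

size-∷ʳ1 : ∀ A → size (A ++ [ 1 ]) ≡ size A + 1
size-∷ʳ1 A = sum-++ A [ 1 ]

size-cut : ∀ A B → size (A ++ 3 ∷ B) ≡ (size A + 1) + (size B + 2)
size-cut A B = trans (sum-++ A (3 ∷ B)) (rearrange (size A) (size B))
  where
  rearrange : ∀ a b → a + (3 + b) ≡ (a + 1) + (b + 2)
  rearrange = solve-∀

P-cut-at-3 : ∀ A B → IsComposition A → B ≢ [] →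
  P (A ++ 3 ∷ B) ≡ binomial (size A + 1) (size B + 2) * (P (A ++ [ 1 ]) * P (2 ∷ B))
P-cut-at-3 A B pA B≢[] = begin
    length (withPeakComp (A ++ 3 ∷ B) (perms (size (A ++ 3 ∷ B))))
  ≡⟨ cong (λ k → length (withPeakComp (A ++ 3 ∷ B) (perms k))) (size-cut A B) ⟩
    length (withPeakComp (A ++ 3 ∷ B) (perms ((size A + 1) + (size B + 2))))
  ≡⟨ CutBijection.count (size A + 1) (size B + 2) (A ++ 3 ∷ B) (A ++ [ 1 ]) (2 ∷ B)
       (λ u v lu lv → cut-at-3⇒ A B u v pA B≢[] lu (subst (2 ≤_) (sym lv) (m≤n+m 2 (size B))))
       (λ u v → cut-at-3⇐ A B u v B≢[]) ⟩
    binomial (size A + 1) (size B + 2) * (Pcount (A ++ [ 1 ]) (size A + 1) * Pcount (2 ∷ B) (size B + 2))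
  ≡⟨ cong₂ (λ x y → binomial (size A + 1) (size B + 2) * (Pcount (A ++ [ 1 ]) x * Pcount (2 ∷ B) y))
       (sym (size-∷ʳ1 A)) (+-comm (size B) 2) ⟩
    binomial (size A + 1) (size B + 2) * (P (A ++ [ 1 ]) * P (2 ∷ B)) ∎
  where
  open ≡-Reasoning
  Pcount : Composition → ℕ → ℕ
  Pcount c m = length (withPeakComp c (perms m))

multinomial-exact : ∀ N ps m → m * prodFact ps ≡ N ! → multinomial N ps ≡ m
multinomial-exact N ps m e =
  trans (cong (λ z → (z / prodFact ps) {{prodFact≢0 ps}}) (sym e)) (m*n/n≡m m (prodFact ps) {{prodFact≢0 ps}})

-- ∏ p! divides (∑ p)!, the quotient being a product of binomial coefficients.
factorials-divide : ∀ ps → ∃ λ m → m * prodFact ps ≡ (sum ps) !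
factorials-divide []       = 1 , refl
factorials-divide (q ∷ qs) with factorials-divide qs
... | m , e = binomial q (sum qs) * m , (begin
    binomial q (sum qs) * m * (q ! * prodFact qs)   ≡⟨ rearrange (binomial q (sum qs)) m (q !) (prodFact qs) ⟩
    binomial q (sum qs) * (q ! * (m * prodFact qs)) ≡⟨ cong (λ z → binomial q (sum qs) * (q ! * z)) e ⟩
    binomial q (sum qs) * (q ! * (sum qs) !)        ≡⟨ binomial-factorials q (sum qs) ⟩
    (q + sum qs) !                                  ∎)
  where
  open ≡-Reasoning
  rearrange : ∀ a b c d → a * b * (c * d) ≡ a * (c * (b * d))
  rearrange = solve-∀

multinomial-factorials : ∀ ps → multinomial (sum ps) ps * prodFact ps ≡ (sum ps) !
multinomial-factorials ps with factorials-divide ps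
... | m , e = trans (cong (_* prodFact ps) (multinomial-exact (sum ps) ps m e)) e

multinomial-pair : ∀ x y → multinomial (x + y) (x ∷ [ y ]) ≡ binomial x y
multinomial-pair x y = multinomial-exact (x + y) (x ∷ [ y ]) (binomial x y)
  (trans (cong (λ z → binomial x y * (x ! * z)) (*-identityʳ (y !))) (binomial-factorials x y))

multinomial-∷ʳ : ∀ Q q → multinomial (sum Q + q) (Q ++ [ q ]) ≡ binomial (sum Q) q * multinomial (sum Q) Q
multinomial-∷ʳ Q q = multinomial-exact (sum Q + q) (Q ++ [ q ]) _ (begin
    L * M * prodFact (Q ++ [ q ])      ≡⟨ cong (L * M *_) prodFact-∷ʳ ⟩
    L * M * (prodFact Q * (q ! * 1))   ≡⟨ rearrange L M (prodFact Q) (q !) ⟩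
    L * ((M * prodFact Q) * q !)       ≡⟨ cong (λ z → L * (z * q !)) (multinomial-factorials Q) ⟩
    L * ((sum Q) ! * q !)              ≡⟨ binomial-factorials (sum Q) q ⟩
    (sum Q + q) !                      ∎)
  where
  open ≡-Reasoning
  L = binomial (sum Q) q
  M = multinomial (sum Q) Q
  prodFact-∷ʳ : prodFact (Q ++ [ q ]) ≡ prodFact Q * (q ! * 1)
  prodFact-∷ʳ = trans (cong product (map-++ _! Q [ q ])) (product-++ (map _! Q) (map _! [ q ]))
  rearrange : ∀ a b c d → a * b * (c * (d * 1)) ≡ a * ((b * c) * d)
  rearrange = solve-∀

totalSize : ℕ → (ℕ → Composition) → ℕ
totalSize k c = sum (map (λ i → size (c i)) (range0 (k + 1))) + 3 * k

partSizes : ℕ → (ℕ → Composition) → List ℕ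
partSizes k c = (size (c 0) + 1) ∷ (map (λ i → 3 + size (c i)) (range1 (k ∸ 1)) ++ [ size (c k) + 2 ])

middleFactors : ℕ → (ℕ → Composition) → ℕ
middleFactors k c = product (map (λ i → P (2 ∷ (c i ++ [ 1 ]))) (range1 (k ∸ 1)))

formula : ℕ → (ℕ → Composition) → ℕ
formula k c = multinomial (totalSize k c) (partSizes k c) * P (c 0 ++ [ 1 ]) * middleFactors k c * P (2 ∷ c k)

range1-∷ʳ : ∀ m → range1 (suc m) ≡ range1 m ++ [ suc m ]
range1-∷ʳ m = sym (applyUpTo-∷ʳ suc m)

range0-∷ʳ : ∀ m → range0 (suc m) ≡ range0 m ++ [ m ]
range0-∷ʳ m = sym (applyUpTo-∷ʳ (λ i → i) m)

sum-range1-∷ʳ : ∀ (g : ℕ → ℕ) m → sum (map g (range1 (suc m))) ≡ sum (map g (range1 m)) + (g (suc m) + 0)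
sum-range1-∷ʳ g m =
  trans (cong (λ l → sum (map g l)) (range1-∷ʳ m)) (trans (cong sum (map-++ g (range1 m) _)) (sum-++ (map g (range1 m)) _))

sum-range0-∷ʳ : ∀ (g : ℕ → ℕ) m → sum (map g (range0 (suc m))) ≡ sum (map g (range0 m)) + (g m + 0)
sum-range0-∷ʳ g m =
  trans (cong (λ l → sum (map g l)) (range0-∷ʳ m)) (trans (cong sum (map-++ g (range0 m) _)) (sum-++ (map g (range0 m)) _))

size-join3 : ∀ c m → size (join3 c m) ≡ size (c 0) + sum (map (λ i → 3 + size (c i)) (range1 m))
size-join3 c zero    = sym (+-identityʳ _)
size-join3 c (suc m) = begin
    size (join3 c m ++ 3 ∷ c (suc m))              ≡⟨ sum-++ (join3 c m) (3 ∷ c (suc m)) ⟩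
    size (join3 c m) + (3 + size (c (suc m)))      ≡⟨ cong (_+ (3 + size (c (suc m)))) (size-join3 c m) ⟩
    size (c 0) + S + (3 + size (c (suc m)))        ≡⟨ rearrange (size (c 0)) S (size (c (suc m))) ⟩
    size (c 0) + (S + ((3 + size (c (suc m))) + 0)) ≡⟨ cong (size (c 0) +_) (sym (sum-range1-∷ʳ g m)) ⟩
    size (c 0) + sum (map g (range1 (suc m)))      ∎
  where
  open ≡-Reasoning
  g = λ i → 3 + size (c i)
  S = sum (map g (range1 m))
  rearrange : ∀ a s x → a + s + (3 + x) ≡ a + (s + ((3 + x) + 0))
  rearrange = solve-∀

totalSize-join3 : ∀ c k → totalSize k c ≡ size (join3 c k)
totalSize-join3 c zero    = trans (+-identityʳ _) (+-identityʳ _)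
totalSize-join3 c (suc k) = begin
    sum (map s (range0 (suc (k + 1)))) + 3 * suc k  ≡⟨ cong (_+ 3 * suc k) (sum-range0-∷ʳ s (k + 1)) ⟩
    S + (s (k + 1) + 0) + 3 * suc k                 ≡⟨ cong (λ z → S + (s z + 0) + 3 * suc k) (+-comm k 1) ⟩
    S + (s (suc k) + 0) + 3 * suc k                 ≡⟨ rearrange S (s (suc k)) k ⟩
    (S + 3 * k) + (3 + s (suc k))                   ≡⟨ cong (_+ (3 + s (suc k))) (totalSize-join3 c k) ⟩
    size (join3 c k) + (3 + s (suc k))              ≡⟨ sym (sum-++ (join3 c k) (3 ∷ c (suc k))) ⟩
    size (join3 c (suc k))                          ∎
  where
  open ≡-Reasoning
  s = λ i → size (c i)
  S = sum (map s (range0 (k + 1)))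
  rearrange : ∀ a x j → a + (x + 0) + 3 * suc j ≡ (a + 3 * j) + (3 + x)
  rearrange = solve-∀

sum-partSizes : ∀ c m → sum (partSizes (suc m) c) ≡ size (join3 c (suc m))
sum-partSizes c m = begin
    (size (c 0) + 1) + sum (map g (range1 m) ++ [ size (c (suc m)) + 2 ])
      ≡⟨ cong ((size (c 0) + 1) +_) (sum-++ (map g (range1 m)) [ size (c (suc m)) + 2 ]) ⟩
    (size (c 0) + 1) + (sum (map g (range1 m)) + ((size (c (suc m)) + 2) + 0))
      ≡⟨ rearrange (size (c 0)) (sum (map g (range1 m))) (size (c (suc m))) ⟩
    (size (c 0) + sum (map g (range1 m))) + (3 + size (c (suc m)))
      ≡⟨ cong (_+ (3 + size (c (suc m)))) (sym (size-join3 c m)) ⟩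
    size (join3 c m) + (3 + size (c (suc m)))
      ≡⟨ sym (sum-++ (join3 c m) (3 ∷ c (suc m))) ⟩
    size (join3 c (suc m)) ∎
  where
  open ≡-Reasoning
  g = λ i → 3 + size (c i)
  rearrange : ∀ a s x → (a + 1) + (s + ((x + 2) + 0)) ≡ (a + s) + (3 + x)
  rearrange = solve-∀

-- The block c j extended by a final part 1: cutting off the last block of
-- join3 c (suc m) leaves join3 c (suc m) ⊕ (1), which is again of the form
-- join3 c′ (suc m) with c′ = appendOneAt c (suc m).
appendOneAt : (ℕ → Composition) → ℕ → ℕ → Composition
appendOneAt c j i with i ≟ j
... | yes _ = c i ++ [ 1 ]
... | no  _ = c i

appendOneAt-here : ∀ c j → appendOneAt c j j ≡ c j ++ [ 1 ]
appendOneAt-here c j with j ≟ j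
... | yes _   = refl
... | no  j≢j = ⊥-elim (j≢j refl)

appendOneAt-before : ∀ c j i → i < j → appendOneAt c j i ≡ c i
appendOneAt-before c j i i<j with i ≟ j
... | yes i≡j = ⊥-elim (<⇒≢ i<j i≡j)
... | no  _   = refl

appendOneAt-composition : ∀ c j i → IsComposition (c i) → IsComposition (appendOneAt c j i)
appendOneAt-composition c j i ci with i ≟ j
... | yes _ = All.++⁺ ci (s≤s z≤n ∷ [])
... | no  _ = ci

join3-composition : ∀ c j → (∀ i → i ≤ j → IsComposition (c i)) → IsComposition (join3 c j)
join3-composition c zero    h = h 0 z≤n
join3-composition c (suc j) h =
  All.++⁺ (join3-composition c j (λ i i≤j → h i (m≤n⇒m≤1+n i≤j))) (s≤s z≤n ∷ h (suc j) ≤-refl)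

join3-cong : ∀ c c′ j → (∀ i → i ≤ j → c i ≡ c′ i) → join3 c j ≡ join3 c′ j
join3-cong c c′ zero    h = h 0 z≤n
join3-cong c c′ (suc j) h =
  cong₂ (λ a b → a ++ 3 ∷ b) (join3-cong c c′ j (λ i i≤j → h i (m≤n⇒m≤1+n i≤j))) (h (suc j) ≤-refl)

join3-∷ʳ1 : ∀ c m → join3 c (suc m) ++ [ 1 ] ≡ join3 (appendOneAt c (suc m)) (suc m)
join3-∷ʳ1 c m = trans (++-assoc (join3 c m) (3 ∷ c (suc m)) [ 1 ])
  (cong₂ (λ a b → a ++ 3 ∷ b)
    (join3-cong c (appendOneAt c (suc m)) m (λ i i≤m → sym (appendOneAt-before c (suc m) i (s≤s i≤m))))
    (sym (appendOneAt-here c (suc m))))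

module Step (c : ℕ → Composition) (m : ℕ) where

  c′ : ℕ → Composition
  c′ = appendOneAt c (suc m)

  A B : Composition
  A = join3 c (suc m)
  B = c (suc (suc m))

  map-below : ∀ {X : Set} (h : Composition → X) → map (λ i → h (c′ i)) (range1 m) ≡ map (λ i → h (c i)) (range1 m)
  map-below h = map-cong-local (All.tabulate (λ {i} i∈ →
    cong h (appendOneAt-before c (suc m) i (s≤s (proj₂ (∈range1⁻ i∈))))))

  partSizes-step : partSizes (suc (suc m)) c ≡ partSizes (suc m) c′ ++ [ size B + 2 ]
  partSizes-step = cong₂ _∷_ (cong (λ z → size z + 1) (sym (appendOneAt-before c (suc m) 0 (s≤s z≤n)))) (begin
      map g (range1 (suc m)) ++ [ size B + 2 ]
    ≡⟨ cong (λ l → map g l ++ [ size B + 2 ]) (range1-∷ʳ m) ⟩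
      map g (range1 m ++ [ suc m ]) ++ [ size B + 2 ]
    ≡⟨ cong (_++ [ size B + 2 ]) (map-++ g (range1 m) [ suc m ]) ⟩
      (map g (range1 m) ++ [ g (suc m) ]) ++ [ size B + 2 ]
    ≡⟨ cong₂ (λ a b → (a ++ [ b ]) ++ [ size B + 2 ]) (sym (map-below (λ z → 3 + size z))) last-block ⟩
      (map (λ i → 3 + size (c′ i)) (range1 m) ++ [ size (c′ (suc m)) + 2 ]) ++ [ size B + 2 ] ∎)
    where
    open ≡-Reasoning
    g = λ i → 3 + size (c i)
    last-block : 3 + size (c (suc m)) ≡ size (c′ (suc m)) + 2
    last-block = begin
      3 + size (c (suc m))                 ≡⟨ three (size (c (suc m))) ⟩
      size (c (suc m)) + 1 + 2             ≡⟨ cong (_+ 2) (sym (size-∷ʳ1 (c (suc m)))) ⟩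
      size (c (suc m) ++ [ 1 ]) + 2        ≡⟨ cong (λ z → size z + 2) (sym (appendOneAt-here c (suc m))) ⟩
      size (c′ (suc m)) + 2                ∎
      where
      three : ∀ x → 3 + x ≡ x + 1 + 2
      three = solve-∀

  middleFactors-step : middleFactors (suc (suc m)) c ≡ middleFactors (suc m) c′ * (P (2 ∷ (c (suc m) ++ [ 1 ])) * 1)
  middleFactors-step = begin
      product (map F (range1 (suc m)))                   ≡⟨ cong (λ l → product (map F l)) (range1-∷ʳ m) ⟩
      product (map F (range1 m ++ [ suc m ]))            ≡⟨ cong product (map-++ F (range1 m) [ suc m ]) ⟩
      product (map F (range1 m) ++ [ F (suc m) ])        ≡⟨ product-++ (map F (range1 m)) [ F (suc m) ] ⟩
      product (map F (range1 m)) * (F (suc m) * 1)       ≡⟨ cong (λ l → product l * (F (suc m) * 1))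
                                                                 (sym (map-below (λ z → P (2 ∷ (z ++ [ 1 ]))))) ⟩
      middleFactors (suc m) c′ * (F (suc m) * 1)          ∎
    where
    open ≡-Reasoning
    F = λ i → P (2 ∷ (c i ++ [ 1 ]))

  sum-partSizes′ : sum (partSizes (suc m) c′) ≡ size A + 1
  sum-partSizes′ = trans (sum-partSizes c′ m) (trans (cong size (sym (join3-∷ʳ1 c m))) (size-∷ʳ1 A))

  multinomial-step : multinomial (totalSize (suc (suc m)) c) (partSizes (suc (suc m)) c)
                   ≡ binomial (size A + 1) (size B + 2) * multinomial (totalSize (suc m) c′) (partSizes (suc m) c′)
  multinomial-step = begin
      multinomial (totalSize (suc (suc m)) c) (partSizes (suc (suc m)) c)
    ≡⟨ cong₂ multinomial total partSizes-step ⟩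
      multinomial (sum Q + (size B + 2)) (Q ++ [ size B + 2 ])
    ≡⟨ multinomial-∷ʳ Q (size B + 2) ⟩
      binomial (sum Q) (size B + 2) * multinomial (sum Q) Q
    ≡⟨ cong₂ (λ a b → binomial a (size B + 2) * multinomial b Q) sum-partSizes′ total′ ⟩
      binomial (size A + 1) (size B + 2) * multinomial (totalSize (suc m) c′) Q ∎
    where
    open ≡-Reasoning
    Q = partSizes (suc m) c′
    total : totalSize (suc (suc m)) c ≡ sum Q + (size B + 2)
    total = trans (totalSize-join3 c (suc (suc m))) (trans (size-cut A B) (cong (_+ (size B + 2)) (sym sum-partSizes′)))
    total′ : sum Q ≡ totalSize (suc m) c′
    total′ = trans (sum-partSizes c′ m) (sym (totalSize-join3 c′ (suc m)))

  formula-step : formula (suc (suc m)) c ≡ binomial (size A + 1) (size B + 2) * (formula (suc m) c′ * P (2 ∷ B))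
  formula-step = begin
      formula (suc (suc m)) c
    ≡⟨ cong₂ (λ M Π → M * P (c 0 ++ [ 1 ]) * Π * P (2 ∷ B)) multinomial-step middleFactors-step ⟩
      L * M′ * P₀ * (Π′ * (Pₘ * 1)) * P (2 ∷ B)
    ≡⟨ rearrange L M′ P₀ Π′ Pₘ (P (2 ∷ B)) ⟩
      L * (M′ * P₀ * Π′ * Pₘ * P (2 ∷ B))
    ≡⟨ cong₂ (λ a b → L * (M′ * P (a ++ [ 1 ]) * Π′ * P (2 ∷ b) * P (2 ∷ B)))
         (sym (appendOneAt-before c (suc m) 0 (s≤s z≤n))) (sym (appendOneAt-here c (suc m))) ⟩
      L * (formula (suc m) c′ * P (2 ∷ B)) ∎
    where
    open ≡-Reasoning
    L  = binomial (size A + 1) (size B + 2)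
    M′ = multinomial (totalSize (suc m) c′) (partSizes (suc m) c′)
    P₀ = P (c 0 ++ [ 1 ])
    Π′ = middleFactors (suc m) c′
    Pₘ = P (2 ∷ (c (suc m) ++ [ 1 ]))
    rearrange : ∀ l a b d e f → l * a * b * (d * (e * 1)) * f ≡ l * (a * b * d * e * f)
    rearrange = solve-∀

-- The theorem for k = m+1, by induction on m: cut off the last block with
-- `P-cut-at-3` and apply the induction hypothesis to c′ = appendOneAt c (suc m).
P-join3 : ∀ m c → (∀ i → i ≤ suc m → IsComposition (c i)) → c (suc m) ≢ [] →
  P (join3 c (suc m)) ≡ formula (suc m) c
P-join3 zero c comp c₁≢[] = begin
    P (c 0 ++ 3 ∷ c 1)                       ≡⟨ P-cut-at-3 (c 0) (c 1) (comp 0 z≤n) c₁≢[] ⟩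
    binomial x y * (P₀ * P₁)                 ≡⟨ rearrange (binomial x y) P₀ P₁ ⟩
    binomial x y * P₀ * 1 * P₁               ≡⟨ cong (λ z → z * P₀ * 1 * P₁) (sym multinomial-two) ⟩
    formula 1 c                              ∎
  where
  open ≡-Reasoning
  x = size (c 0) + 1
  y = size (c 1) + 2
  P₀ = P (c 0 ++ [ 1 ])
  P₁ = P (2 ∷ c 1)
  multinomial-two : multinomial (totalSize 1 c) (x ∷ [ y ]) ≡ binomial x y
  multinomial-two = trans (cong (λ N → multinomial N (x ∷ [ y ])) (trans (totalSize-join3 c 1) (size-cut (c 0) (c 1))))
                          (multinomial-pair x y)
  rearrange : ∀ a b d → a * (b * d) ≡ a * b * 1 * d
  rearrange = solve-∀
P-join3 (suc m) c comp last≢[] = begin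
    P (A ++ 3 ∷ B)                          ≡⟨ P-cut-at-3 A B A-comp last≢[] ⟩
    L * (P (A ++ [ 1 ]) * P (2 ∷ B))        ≡⟨ cong (λ z → L * (P z * P (2 ∷ B))) (join3-∷ʳ1 c m) ⟩
    L * (P (join3 c′ (suc m)) * P (2 ∷ B))  ≡⟨ cong (λ z → L * (z * P (2 ∷ B))) (P-join3 m c′ comp′ last′≢[]) ⟩
    L * (formula (suc m) c′ * P (2 ∷ B))    ≡⟨ sym formula-step ⟩
    formula (suc (suc m)) c                 ∎
  where
  open ≡-Reasoning
  open Step c m
  L = binomial (size A + 1) (size B + 2)
  A-comp : IsComposition A
  A-comp = join3-composition c (suc m) (λ i i≤ → comp i (m≤n⇒m≤1+n i≤))
  comp′ : ∀ i → i ≤ suc m → IsComposition (c′ i)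
  comp′ i i≤ = appendOneAt-composition c (suc m) i (comp i (m≤n⇒m≤1+n i≤))
  last′≢[] : c′ (suc m) ≢ []
  last′≢[] e = []≢∷ʳ (c (suc m)) 1 (trans (sym e) (appendOneAt-here c (suc m)))

proposition5p2 : (k : ℕ) → 1 ≤ k → (c : ℕ → Composition) →
    (∀ i → i ≤ k → IsComposition (c i)) → c k ≢ [] →
    P (join3 c k) ≡
      multinomial (sum (map (λ i → size (c i)) (range0 (k + 1))) + 3 * k)
                  ((size (c 0) + 1) ∷ (map (λ i → 3 + size (c i)) (range1 (k ∸ 1)) ++ [ size (c k) + 2 ]))
      * P (c 0 ++ [ 1 ])
      * product (map (λ i → P (2 ∷ (c i ++ [ 1 ]))) (range1 (k ∸ 1)))
      * P (2 ∷ c k)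
proposition5p2 (suc m) _ c comp last≢[] = P-join3 m c comp last≢[]
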